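{- Let $k\ge0$ and $j$ be integers. Then \begin{align*} \beta_{0,k,j}&=\delta_{k,j},\\ \beta_{0^c_k,k,j}&=2^k\delta_{j,0},\\ \beta_{2t,k+1,j}&=\beta_{t,k,j-1}+\beta_{t-1,k,j+1}&&\text{for }0\le t<2^k,\\ \beta_{2t+1,k+1,j}&=2\beta_{t,k,j}&&\text{for }0\le t<2^k,\\ \beta_{(2t)^c_{k+1},k+1,j}&=2\beta_{t^c_k,k,j}&&\text{for }0\le t<2^k,\\ \beta_{(2t+1)^c_{k+1},k+1,j}&=\beta_{t^c_k,k,j-1}+\beta_{(t+1)^c_k,k,j+1}&&\text{for }0\le t<2^k. \end{align*} Furthermore, $\beta_{t,k,j}=0$ for $\lvert j\rvert>k$.
   Context: For a nonnegative integer $n$, $w(n)$ denotes the number of $1$s in the binary expansion of $n$. For integers $k\ge0$ and $t$, write $t^c_k=2^k-1-t$. For integers $k\ge0$, $0\le t<2^k$ and $j\in\mathbb Z$ define \[\beta_{t,k,j}=\bigl\lvert\{a\in\{0,\ldots,t\}: w(a+t^c_k)-w(a)=j\}\bigr\rvert,\] and set $\beta_{ -1,k,j}=0$ for all $k,j$. $\delta$ denotes the Kronecker delta. -}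

module Defs where

open import Data.Nat using (ℕ; zero; suc; _+_; _*_; _∸_; _^_; _%_; _/_)
open import Data.Integer as ℤ using (ℤ; +_; -[1+_])
import Data.Integer.Properties as ℤP
open import Data.List using (List; filter; length; upTo)
open import Relation.Nullary.Decidable using (does)
open import Data.Bool using (if_then_else_)

-- binary digit sum w(n) (fuel n suffices since n / 2 < n for n > 0)
wAux : ℕ → ℕ → ℕ
wAux zero    n = 0
wAux (suc f) n = n % 2 + wAux f (n / 2)

w : ℕ → ℕ
w n = wAux n n

comp : ℕ → ℤ → ℤ
comp k t = (+ (2 ^ k)) ℤ.- (+ 1) ℤ.- t

δ : ℤ → ℤ → ℕ
δ a b = if does (a ℤP.≟ b) then 1 else 0

-- β_{t,k,j} for t ≥ 0 : #{a ∈ {0..t} : w(a + t^c_k) - w(a) = j}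
-- (only meaningful for t < 2^k, where t^c_k = 2^k ∸ 1 ∸ t exactly);
-- β_{t,k,j} = 0 for negative t (the paper uses only t = -1).
β : ℤ → ℕ → ℤ → ℕ
β (+ t)    k j = length (filter (λ a → ((+ w (a + (2 ^ k ∸ 1 ∸ t))) ℤ.- (+ w a)) ℤP.≟ j) (upTo (suc t)))
β -[1+ n ] k j = 0

module Submission where

-- Put  D_s(a) = w(a + s) − w(a)  and let  count d j n  be the
-- number of  a < n  with  d a = j.  If  x + y = 2^k  then  y − 1  has
-- complement  x,  so
--     β_{y−1,k,j} = count D_x j y        and        (x)^c_k = y − 1,
-- i.e. both β_{t,k,j} and β_{t^c_k,k,j} are counts of the same shape, with
-- the roles of t and t^c exchanged.  Splitting a count according to the
-- parity of a, and using  w(2n) = w(n),  w(2n+1) = w(n) + 1,  gives two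
-- recurrences that do not mention k at all:
--     count D_{2s}   j (2n)     = 2 · count D_s j n,
--     count D_{2s+1} j (2t+1)   = count D_s (j−1) (t+1) + count D_{s+1} (j+1) t.
-- Each of the six identities of the proposition is one of these two
-- recurrences read through the dictionary above (the complement identities
-- use the same recurrence as the direct ones with t and t^c swapped).
-- The vanishing for |j| > k holds because w(n) ≤ k for n < 2^k.

open import Defs
open import Data.Nat using (ℕ; suc; _+_; _*_; _^_; _<_)
open import Data.Integer as ℤ using (ℤ; +_; ∣_∣)
open import Data.Product using (_×_)
open import Relation.Binary.PropositionalEquality using (_≡_)

open import Data.Nat using (zero; _∸_; _%_; _/_; _≤_; z≤n; s≤s)
import Data.Nat.Properties as ℕP
open import Data.Nat.DivMod using (m/n<m; m*n%n≡0; m*n/n≡m; [m+kn]%n≡m%n; +-distrib-/; m%n<n; m<n*o⇒m/o<n)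
import Data.Integer.Properties as ℤP
open import Data.List using (filter; length; upTo; _∷_; []; _++_)
import Data.List.Properties as LP
open import Relation.Nullary.Decidable using (Dec; yes; no)
open import Relation.Nullary using (¬_)
open import Data.Product using (_,_)
open import Data.Empty using (⊥-elim)
open import Relation.Binary.PropositionalEquality using (refl; sym; trans; cong; cong₂; subst; module ≡-Reasoning)
open import Data.Integer.Tactic.RingSolver using (solve-∀)
import Data.Nat.Tactic.RingSolver as ℕSolver

open ≡-Reasoning

count : (ℕ → ℤ) → ℤ → ℕ → ℕ
count d j zero    = 0
count d j (suc n) = count d j n + δ (d n) j

length-filter-upTo : ∀ (d : ℕ → ℤ) j n →
  length (filter (λ a → d a ℤP.≟ j) (upTo n)) ≡ count d j n
length-filter-upTo d j zero    = refl
length-filter-upTo d j (suc n) = begin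
    length (filter P (upTo (suc n)))
  ≡⟨ cong (λ l → length (filter P l)) (sym (LP.applyUpTo-∷ʳ (λ x → x) n)) ⟩
    length (filter P (upTo n ++ n ∷ []))
  ≡⟨ cong length (LP.filter-++ P (upTo n) (n ∷ [])) ⟩
    length (filter P (upTo n) ++ filter P (n ∷ []))
  ≡⟨ LP.length-++ (filter P (upTo n)) ⟩
    length (filter P (upTo n)) + length (filter P (n ∷ []))
  ≡⟨ cong₂ _+_ (length-filter-upTo d j n) singleton ⟩
    count d j (suc n) ∎
  where
  P : ∀ a → Dec (d a ≡ j)
  P a = d a ℤP.≟ j
  singleton : length (filter P (n ∷ [])) ≡ δ (d n) j
  singleton with d n ℤP.≟ j
  ... | yes _ = refl
  ... | no _  = refl

count-cong : ∀ {d e : ℕ → ℤ} j n → (∀ a → d a ≡ e a) → count d j n ≡ count e j n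
count-cong j zero    d≡e = refl
count-cong j (suc n) d≡e = cong₂ _+_ (count-cong j n d≡e) (cong (λ x → δ x j) (d≡e n))

count-shift : ∀ (e : ℕ → ℤ) c j n → count (λ a → e a ℤ.+ c) j n ≡ count e (j ℤ.- c) n
count-shift e c j zero    = refl
count-shift e c j (suc n) = cong₂ _+_ (count-shift e c j n) (δ-shift (e n))
  where
  add-sub : ∀ (x c : ℤ) → x ≡ x ℤ.+ c ℤ.- c
  add-sub = solve-∀
  sub-add : ∀ (j c : ℤ) → j ℤ.- c ℤ.+ c ≡ j
  sub-add = solve-∀
  δ-shift : ∀ x → δ (x ℤ.+ c) j ≡ δ x (j ℤ.- c)
  δ-shift x with x ℤ.+ c ℤP.≟ j | x ℤP.≟ j ℤ.- c
  ... | yes _ | yes _ = refl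
  ... | no _  | no _  = refl
  ... | yes p | no q  = ⊥-elim (q (trans (add-sub x c) (cong (ℤ._- c) p)))
  ... | no p  | yes q = ⊥-elim (p (trans (cong (ℤ._+ c) q) (sub-add j c)))

double-suc : ∀ n → 2 * suc n ≡ suc (suc (2 * n))
double-suc = ℕSolver.solve-∀

count-even-range : ∀ (d : ℕ → ℤ) j n →
  count d j (2 * n) ≡ count (λ b → d (2 * b)) j n + count (λ b → d (suc (2 * b))) j n
count-even-range d j zero    = refl
count-even-range d j (suc n) = begin
    count d j (2 * suc n)
  ≡⟨ cong (count d j) (double-suc n) ⟩
    count d j (2 * n) + δ (d (2 * n)) j + δ (d (suc (2 * n))) j
  ≡⟨ cong (λ x → x + δ (d (2 * n)) j + δ (d (suc (2 * n))) j) (count-even-range d j n) ⟩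
    ceven + codd + δ (d (2 * n)) j + δ (d (suc (2 * n))) j
  ≡⟨ regroup ceven codd (δ (d (2 * n)) j) (δ (d (suc (2 * n))) j) ⟩
    (ceven + δ (d (2 * n)) j) + (codd + δ (d (suc (2 * n))) j) ∎
  where
  ceven codd : ℕ
  ceven = count (λ b → d (2 * b)) j n
  codd  = count (λ b → d (suc (2 * b))) j n
  regroup : ∀ a b c e → a + b + c + e ≡ a + c + (b + e)
  regroup = ℕSolver.solve-∀

count-const : ∀ c j n → count (λ _ → c) j n ≡ n * δ c j
count-const c j zero    = refl
count-const c j (suc n) = trans (cong (_+ δ c j) (count-const c j n)) (ℕP.+-comm (n * δ c j) (δ c j))

count-none : ∀ (d : ℕ → ℤ) j n → (∀ a → a < n → ¬ d a ≡ j) → count d j n ≡ 0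
count-none d j zero    _      = refl
count-none d j (suc n) misses with d n ℤP.≟ j
... | yes hit = ⊥-elim (misses n ℕP.≤-refl hit)
... | no _    = trans (ℕP.+-identityʳ _) (count-none d j n (λ a a<n → misses a (ℕP.m<n⇒m<1+n a<n)))

δ-sym : ∀ a b → δ a b ≡ δ b a
δ-sym a b with a ℤP.≟ b | b ℤP.≟ a
... | yes _ | yes _ = refl
... | no _  | no _  = refl
... | yes p | no q  = ⊥-elim (q (sym p))
... | no p  | yes q = ⊥-elim (p (sym q))

-- The binary digit sum.  Defs computes w n with fuel n; any fuel ≥ n gives
-- the same value, which yields the recursion w n = n % 2 + w (n / 2).

wAux-zero : ∀ f → wAux f 0 ≡ 0
wAux-zero zero    = refl
wAux-zero (suc f) = wAux-zero f

half≤ : ∀ n f → n ≤ suc f → n / 2 ≤ f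
half≤ zero    f _  = z≤n
half≤ (suc m) f le = ℕP.≤-pred (ℕP.≤-trans (m/n<m (suc m) 2 (s≤s (s≤s z≤n))) le)

wAux-fuel : ∀ f g n → n ≤ f → n ≤ g → wAux f n ≡ wAux g n
wAux-fuel zero    g       .zero z≤n _   = sym (wAux-zero g)
wAux-fuel (suc f) zero    .zero _   z≤n = wAux-zero (suc f)
wAux-fuel (suc f) (suc g) n     p   q   =
  cong (_+_ (n % 2)) (wAux-fuel f g (n / 2) (half≤ n f p) (half≤ n g q))

w-rec : ∀ n → w n ≡ n % 2 + w (n / 2)
w-rec zero    = refl
w-rec (suc m) = cong (_+_ (suc m % 2))
  (wAux-fuel m (suc m / 2) (suc m / 2) (half≤ (suc m) m ℕP.≤-refl) ℕP.≤-refl)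

w-double : ∀ n → w (2 * n) ≡ w n
w-double n = trans (w-rec (2 * n)) (cong₂ (λ r q → r + w q) rem quot)
  where
  rem : 2 * n % 2 ≡ 0
  rem = trans (cong (_% 2) (ℕP.*-comm 2 n)) (m*n%n≡0 n 2)
  quot : 2 * n / 2 ≡ n
  quot = trans (cong (_/ 2) (ℕP.*-comm 2 n)) (m*n/n≡m n 2)

w-double+1 : ∀ n → w (suc (2 * n)) ≡ suc (w n)
w-double+1 n = trans (w-rec (suc (2 * n))) (cong₂ (λ r q → r + w q) rem quot)
  where
  swap : suc (2 * n) ≡ 1 + n * 2
  swap = cong suc (ℕP.*-comm 2 n)
  rem : suc (2 * n) % 2 ≡ 1
  rem = trans (cong (_% 2) swap) ([m+kn]%n≡m%n 1 n 2)
  quot : suc (2 * n) / 2 ≡ n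
  quot = trans (cong (_/ 2) swap) (trans
    (+-distrib-/ 1 (n * 2) {2} (subst (λ r → 1 + r < 2) (sym (m*n%n≡0 n 2)) (s≤s (s≤s z≤n))))
    (m*n/n≡m n 2))

w-bound : ∀ k n → n < 2 ^ k → w n ≤ k
w-bound zero    zero    _        = z≤n
w-bound zero    (suc n) (s≤s ())
w-bound (suc k) n       n<2^k+1 rewrite w-rec n =
  ℕP.+-mono-≤ (ℕP.≤-pred (m%n<n n 2))
              (w-bound k (n / 2) (m<n*o⇒m/o<n (subst (n <_) (ℕP.*-comm 2 (2 ^ k)) n<2^k+1)))

w-all-ones : ∀ k → w (2 ^ k ∸ 1) ≡ k
w-all-ones zero    = refl
w-all-ones (suc k) with 2 ^ k | ℕP.m^n>0 2 k | w-all-ones k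
... | suc p | _ | w[p]≡k = begin
    w (2 * suc p ∸ 1) ≡⟨ cong (λ x → w (x ∸ 1)) (double-suc p) ⟩
    w (suc (2 * p))   ≡⟨ w-double+1 p ⟩
    suc (w p)         ≡⟨ cong suc w[p]≡k ⟩
    suc k             ∎

D : ℕ → ℕ → ℤ
D s a = + w (a + s) ℤ.- + w a

D-cong : ∀ {x y x' y'} → x ≡ x' → y ≡ y' → + x ℤ.- + y ≡ + x' ℤ.- + y'
D-cong = cong₂ (λ x y → + x ℤ.- + y)

D-even-even : ∀ s b → D (2 * s) (2 * b) ≡ D s b
D-even-even s b = D-cong (trans (cong w (sym (ℕP.*-distribˡ-+ 2 b s))) (w-double (b + s))) (w-double b)

D-even-odd : ∀ s b → D (2 * s) (suc (2 * b)) ≡ D s b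
D-even-odd s b = trans
  (D-cong (trans (cong (λ n → w (suc n)) (sym (ℕP.*-distribˡ-+ 2 b s))) (w-double+1 (b + s))) (w-double+1 b))
  (carry (+ w (b + s)) (+ w b))
  where
  carry : ∀ (X Y : ℤ) → (+ 1 ℤ.+ X) ℤ.- (+ 1 ℤ.+ Y) ≡ X ℤ.- Y
  carry = solve-∀

D-odd-even : ∀ s b → D (2 * s + 1) (2 * b) ≡ D s b ℤ.+ + 1
D-odd-even s b = trans
  (D-cong (trans (cong w (arith b s)) (w-double+1 (b + s))) (w-double b))
  (carry (+ w (b + s)) (+ w b))
  where
  arith : ∀ b s → 2 * b + (2 * s + 1) ≡ suc (2 * (b + s))
  arith = ℕSolver.solve-∀
  carry : ∀ (X Y : ℤ) → (+ 1 ℤ.+ X) ℤ.- Y ≡ (X ℤ.- Y) ℤ.+ + 1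
  carry = solve-∀

D-odd-odd : ∀ s b → D (2 * s + 1) (suc (2 * b)) ≡ D (s + 1) b ℤ.+ ℤ.- + 1
D-odd-odd s b = trans
  (D-cong (trans (cong w (arith b s)) (w-double (b + (s + 1)))) (w-double+1 b))
  (carry (+ w (b + (s + 1))) (+ w b))
  where
  arith : ∀ b s → suc (2 * b) + (2 * s + 1) ≡ 2 * (b + (s + 1))
  arith = ℕSolver.solve-∀
  carry : ∀ (X Y : ℤ) → X ℤ.- (+ 1 ℤ.+ Y) ≡ (X ℤ.- Y) ℤ.+ ℤ.- + 1
  carry = solve-∀

D-bound : ∀ k s a → a + s < 2 ^ k → ∣ D s a ∣ ≤ k
D-bound k s a a+s<2^k =
  subst (_≤ k) (cong ∣_∣ (sym (ℤP.[+m]-[+n]≡m⊖n (w (a + s)) (w a))))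
    (ℕP.≤-trans (ℤP.∣m⊝n∣≤m⊔n (w (a + s)) (w a))
                (ℕP.⊔-lub (w-bound k (a + s) a+s<2^k)
                          (w-bound k a (ℕP.≤-<-trans (ℕP.m≤m+n a s) a+s<2^k))))

count-D-even : ∀ s j n → count (D (2 * s)) j (2 * n) ≡ 2 * count (D s) j n
count-D-even s j n = begin
    count (D (2 * s)) j (2 * n)
  ≡⟨ count-even-range (D (2 * s)) j n ⟩
    count (λ b → D (2 * s) (2 * b)) j n + count (λ b → D (2 * s) (suc (2 * b))) j n
  ≡⟨ cong₂ _+_ (count-cong j n (D-even-even s)) (count-cong j n (D-even-odd s)) ⟩
    count (D s) j n + count (D s) j n
  ≡⟨ cong (_+_ (count (D s) j n)) (sym (ℕP.+-identityʳ _)) ⟩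
    2 * count (D s) j n ∎

-- Odd shift: even a gain a carry (+1), odd a lose one (−1) with shift s + 1.
count-D-odd : ∀ s j t →
  count (D (2 * s + 1)) j (suc (2 * t)) ≡ count (D s) (j ℤ.- + 1) (suc t) + count (D (s + 1)) (j ℤ.+ + 1) t
count-D-odd s j t = begin
    count (D (2 * s + 1)) j (suc (2 * t))
  ≡⟨ cong (_+ δ (D (2 * s + 1) (2 * t)) j) (count-even-range (D (2 * s + 1)) j t) ⟩
    count evens j t + count odds j t + δ (evens t) j
  ≡⟨ regroup (count evens j t) (count odds j t) (δ (evens t) j) ⟩
    count evens j (suc t) + count odds j t
  ≡⟨ cong₂ _+_ (trans (count-cong j (suc t) (D-odd-even s)) (count-shift (D s) (+ 1) j (suc t)))
               (trans (count-cong j t (D-odd-odd s)) (count-shift (D (s + 1)) (ℤ.- + 1) j t)) ⟩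
    count (D s) (j ℤ.- + 1) (suc t) + count (D (s + 1)) (j ℤ.+ + 1) t ∎
  where
  evens odds : ℕ → ℤ
  evens b = D (2 * s + 1) (2 * b)
  odds  b = D (2 * s + 1) (suc (2 * b))
  regroup : ∀ a b c → a + b + c ≡ a + c + b
  regroup = ℕSolver.solve-∀

β-pred-count : ∀ k x y j → x + y ≡ 2 ^ k → β (+ y ℤ.- + 1) k j ≡ count (D x) j y
β-pred-count k x zero    j _ = refl
β-pred-count k x (suc t) j x+y≡2^k =
  trans (length-filter-upTo (D (2 ^ k ∸ 1 ∸ t)) j (suc t)) (cong (λ s → count (D s) j (suc t)) complement)
  where
  complement : 2 ^ k ∸ 1 ∸ t ≡ x
  complement = begin
    2 ^ k ∸ 1 ∸ t     ≡⟨ cong (λ n → n ∸ 1 ∸ t) (sym x+y≡2^k) ⟩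
    x + suc t ∸ 1 ∸ t ≡⟨ cong (_∸ t) (cong (_∸ 1) (ℕP.+-suc x t)) ⟩
    x + t ∸ t         ≡⟨ ℕP.m+n∸n≡m x t ⟩
    x                 ∎

β-count : ∀ k x t j → x + suc t ≡ 2 ^ k → β (+ t) k j ≡ count (D x) j (suc t)
β-count k x t = β-pred-count k x (suc t)

comp-pred : ∀ k x y → x + y ≡ 2 ^ k → comp k (+ x) ≡ + y ℤ.- + 1
comp-pred k x y x+y≡2^k rewrite sym x+y≡2^k = cancel (+ x) (+ y)
  where
  cancel : ∀ (X Y : ℤ) → (X ℤ.+ Y ℤ.- + 1) ℤ.- X ≡ Y ℤ.- + 1
  cancel = solve-∀

β-comp-count : ∀ k x y j → x + y ≡ 2 ^ k → β (comp k (+ x)) k j ≡ count (D x) j y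
β-comp-count k x y j x+y≡2^k =
  trans (cong (λ t → β t k j) (comp-pred k x y x+y≡2^k)) (β-pred-count k x y j x+y≡2^k)

complement-split : ∀ k t → t < 2 ^ k → (2 ^ k ∸ suc t) + suc t ≡ 2 ^ k
complement-split k t t<2^k = ℕP.m∸n+n≡m t<2^k

complement-split′ : ∀ k t → t < 2 ^ k → t + suc (2 ^ k ∸ suc t) ≡ 2 ^ k
complement-split′ k t t<2^k =
  trans (ℕP.+-suc t _) (trans (ℕP.+-comm (suc t) _) (complement-split k t t<2^k))

double-split-odd : ∀ k s t → s + suc t ≡ 2 ^ k → (2 * s + 1) + suc (2 * t) ≡ 2 ^ suc k
double-split-odd k s t split = trans (arith s t) (cong (2 *_) split)
  where
  arith : ∀ s t → (2 * s + 1) + suc (2 * t) ≡ 2 * (s + suc t)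
  arith = ℕSolver.solve-∀

double-split-even : ∀ k s t → s + suc t ≡ 2 ^ k → 2 * s + 2 * suc t ≡ 2 ^ suc k
double-split-even k s t split = trans (sym (ℕP.*-distribˡ-+ 2 s (suc t))) (cong (2 *_) split)

β-zero : ∀ k j → β (+ 0) k j ≡ δ (+ k) j
β-zero k j = begin
    β (+ 0) k j              ≡⟨ β-count k (2 ^ k ∸ 1) 0 j (complement-split k 0 (ℕP.m^n>0 2 k)) ⟩
    δ (D (2 ^ k ∸ 1) 0) j    ≡⟨ cong (λ x → δ x j) (ℤP.+-identityʳ (+ w (2 ^ k ∸ 1))) ⟩
    δ (+ w (2 ^ k ∸ 1)) j    ≡⟨ cong (λ n → δ (+ n) j) (w-all-ones k) ⟩
    δ (+ k) j                ∎

β-comp-zero : ∀ k j → β (comp k (+ 0)) k j ≡ 2 ^ k * δ j (+ 0)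
β-comp-zero k j = begin
    β (comp k (+ 0)) k j        ≡⟨ β-comp-count k 0 (2 ^ k) j refl ⟩
    count (D 0) j (2 ^ k)       ≡⟨ count-cong j (2 ^ k) D-zero ⟩
    count (λ _ → + 0) j (2 ^ k) ≡⟨ count-const (+ 0) j (2 ^ k) ⟩
    2 ^ k * δ (+ 0) j           ≡⟨ cong (2 ^ k *_) (δ-sym (+ 0) j) ⟩
    2 ^ k * δ j (+ 0)           ∎
  where
  D-zero : ∀ a → D 0 a ≡ + 0
  D-zero a rewrite ℕP.+-identityʳ a = ℤP.+-inverseʳ (+ w a)

β-even : ∀ k t j → t < 2 ^ k →
  β (+ (2 * t)) (suc k) j ≡ β (+ t) k (j ℤ.- + 1) + β (+ t ℤ.- + 1) k (j ℤ.+ + 1)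
β-even k t j t<2^k = begin
    β (+ (2 * t)) (suc k) j
  ≡⟨ β-count (suc k) (2 * s + 1) (2 * t) j (double-split-odd k s t split) ⟩
    count (D (2 * s + 1)) j (suc (2 * t))
  ≡⟨ count-D-odd s j t ⟩
    count (D s) (j ℤ.- + 1) (suc t) + count (D (s + 1)) (j ℤ.+ + 1) t
  ≡⟨ sym (cong₂ _+_ (β-count k s t (j ℤ.- + 1) split)
                    (β-pred-count k (s + 1) t (j ℤ.+ + 1) (trans (ℕP.+-assoc s 1 t) split))) ⟩
    β (+ t) k (j ℤ.- + 1) + β (+ t ℤ.- + 1) k (j ℤ.+ + 1) ∎
  where
  s : ℕ
  s = 2 ^ k ∸ suc t
  split : s + suc t ≡ 2 ^ k
  split = complement-split k t t<2^k

β-odd : ∀ k t j → t < 2 ^ k → β (+ (2 * t + 1)) (suc k) j ≡ 2 * β (+ t) k j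
β-odd k t j t<2^k = begin
    β (+ (2 * t + 1)) (suc k) j
  ≡⟨ cong (λ y → β (+ y ℤ.- + 1) (suc k) j) (arith t) ⟩
    β (+ (2 * suc t) ℤ.- + 1) (suc k) j
  ≡⟨ β-pred-count (suc k) (2 * s) (2 * suc t) j (double-split-even k s t split) ⟩
    count (D (2 * s)) j (2 * suc t)
  ≡⟨ count-D-even s j (suc t) ⟩
    2 * count (D s) j (suc t)
  ≡⟨ cong (2 *_) (sym (β-count k s t j split)) ⟩
    2 * β (+ t) k j ∎
  where
  s : ℕ
  s = 2 ^ k ∸ suc t
  split : s + suc t ≡ 2 ^ k
  split = complement-split k t t<2^k
  arith : ∀ t → suc (2 * t + 1) ≡ 2 * suc t
  arith = ℕSolver.solve-∀

β-comp-even : ∀ k t j → t < 2 ^ k → β (comp (suc k) (+ (2 * t))) (suc k) j ≡ 2 * β (comp k (+ t)) k j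
β-comp-even k t j t<2^k = begin
    β (comp (suc k) (+ (2 * t))) (suc k) j
  ≡⟨ β-comp-count (suc k) (2 * t) (2 * suc s) j (double-split-even k t s split) ⟩
    count (D (2 * t)) j (2 * suc s)
  ≡⟨ count-D-even t j (suc s) ⟩
    2 * count (D t) j (suc s)
  ≡⟨ cong (2 *_) (sym (β-comp-count k t (suc s) j split)) ⟩
    2 * β (comp k (+ t)) k j ∎
  where
  s : ℕ
  s = 2 ^ k ∸ suc t
  split : t + suc s ≡ 2 ^ k
  split = complement-split′ k t t<2^k

β-comp-odd : ∀ k t j → t < 2 ^ k →
  β (comp (suc k) (+ (2 * t + 1))) (suc k) j
    ≡ β (comp k (+ t)) k (j ℤ.- + 1) + β (comp k (+ t ℤ.+ + 1)) k (j ℤ.+ + 1)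
β-comp-odd k t j t<2^k = begin
    β (comp (suc k) (+ (2 * t + 1))) (suc k) j
  ≡⟨ β-comp-count (suc k) (2 * t + 1) (suc (2 * s)) j (double-split-odd k t s split) ⟩
    count (D (2 * t + 1)) j (suc (2 * s))
  ≡⟨ count-D-odd t j s ⟩
    count (D t) (j ℤ.- + 1) (suc s) + count (D (t + 1)) (j ℤ.+ + 1) s
  ≡⟨ sym (cong₂ _+_ (β-comp-count k t (suc s) (j ℤ.- + 1) split)
                    (β-comp-count k (t + 1) s (j ℤ.+ + 1) (trans (ℕP.+-assoc t 1 s) split))) ⟩
    β (comp k (+ t)) k (j ℤ.- + 1) + β (comp k (+ t ℤ.+ + 1)) k (j ℤ.+ + 1) ∎
  where
  s : ℕ
  s = 2 ^ k ∸ suc t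
  split : t + suc s ≡ 2 ^ k
  split = complement-split′ k t t<2^k

β-vanishes : ∀ k t j → t < 2 ^ k → k < ∣ j ∣ → β (+ t) k j ≡ 0
β-vanishes k t j t<2^k k<∣j∣ =
  trans (β-count k s t j split) (count-none (D s) j (suc t) too-large)
  where
  s : ℕ
  s = 2 ^ k ∸ suc t
  split : s + suc t ≡ 2 ^ k
  split = complement-split k t t<2^k
  too-large : ∀ a → a < suc t → ¬ D s a ≡ j
  too-large a a<t+1 D≡j = ℕP.<⇒≱ k<∣j∣ (subst (λ i → ∣ i ∣ ≤ k) D≡j (D-bound k s a a+s<2^k))
    where
    a+s<2^k : a + s < 2 ^ k
    a+s<2^k = subst (a + s <_) split (subst (_≤ s + suc t) (ℕP.+-comm s (suc a)) (ℕP.+-monoʳ-≤ s a<t+1))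

proposition4 : (k : ℕ) (j : ℤ) →
      (β (+ 0) k j ≡ δ (+ k) j)
    × (β (comp k (+ 0)) k j ≡ 2 ^ k * δ j (+ 0))
    × (∀ (t : ℕ) → t < 2 ^ k →
         β (+ (2 * t)) (suc k) j ≡ β (+ t) k (j ℤ.- + 1) + β (+ t ℤ.- + 1) k (j ℤ.+ + 1))
    × (∀ (t : ℕ) → t < 2 ^ k →
         β (+ (2 * t + 1)) (suc k) j ≡ 2 * β (+ t) k j)
    × (∀ (t : ℕ) → t < 2 ^ k →
         β (comp (suc k) (+ (2 * t))) (suc k) j ≡ 2 * β (comp k (+ t)) k j)
    × (∀ (t : ℕ) → t < 2 ^ k →
         β (comp (suc k) (+ (2 * t + 1))) (suc k) j
           ≡ β (comp k (+ t)) k (j ℤ.- + 1) + β (comp k (+ t ℤ.+ + 1)) k (j ℤ.+ + 1))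
    × (∀ (t : ℕ) → t < 2 ^ k → k < ∣ j ∣ → β (+ t) k j ≡ 0)
proposition4 k j =
    β-zero k j
  , β-comp-zero k j
  , (λ t → β-even k t j)
  , (λ t → β-odd k t j)
  , (λ t → β-comp-even k t j)
  , (λ t → β-comp-odd k t j)
  , (λ t → β-vanishes k t j)
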